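{- Let $n$ and $q>1$ be positive integers. Let $p\geq q$ be a prime, and assume that $n\not\equiv 0 \pmod p$. Let $\mathcal{H}\subseteq \{0,1,\ldots,q-1\}^n\subseteq \mathbb{F}_p^n$ be a set of vectors such that there exists a positive integer $\lambda\not\equiv 0 \pmod p$ with $d_H(\mathbf{h},\mathbf{g})\equiv \lambda \pmod p$ for each pair of distinct $\mathbf{h},\mathbf{g}\in \mathcal{H}$. Suppose further that $q\lambda \not\equiv n(q-1)+1 \pmod p$. Then $|\mathcal{H}|\leq n(q-1)$.
   Context: For vectors $\mathbf{h}_1,\mathbf{h}_2\in\{0,1,\ldots,q-1\}^n$, the Hamming distance is $d_H(\mathbf{h}_1,\mathbf{h}_2):=|\{i\in \{1,\ldots,n\}:~ (\mathbf{h}_1)_i\neq (\mathbf{h}_2)_i\}|$. -}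

module Defs where

open import Data.Nat using (ℕ; zero; suc; _+_)
open import Data.Fin using (Fin)
open import Data.Fin.Properties using (_≟_)
open import Data.Vec using (Vec; []; _∷_)
open import Relation.Nullary using (yes; no)

dH : ∀ {q n} → Vec (Fin q) n → Vec (Fin q) n → ℕ
dH [] [] = 0
dH (x ∷ xs) (y ∷ ys) with x ≟ y
... | yes _ = dH xs ys
... | no  _ = suc (dH xs ys)

module Submission where

-- Suppose H contains m = n(q−1)+1 words h_j.  Each word x defines the point
-- (δ(x_i, a) − δ(x_i, 0))_{i < n, 0 < a < q} of 𝔽_pⁿ⁽ᑫ⁻¹⁾, so these m points satisfy a
-- nontrivial linear relation Σ_j c_j h_j = 0.  Equivalently, for every coordinate i the column
-- sum S_i(b) = Σ_j c_j δ(h_{j,i}, b) is independent of the letter b.  Pairing with a word h_g,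
-- Σ_j c_j agree(h_j, h_g) = Σ_i S_i(h_{g,i}) = Σ_i S_i(0) =: T does not depend on g; the distance
-- condition makes the same sum c_g λ + C (n − λ) with C = Σ_j c_j, so all c_j equal some c ≠ 0
-- and C = m c.  Since Σ_b S_i(b) = C, also q T = n C, and together these give
-- c n (q − 1) (m − q λ) = 0 in 𝔽_p, i.e. m ≡ q λ (mod p).

open import Defs
open import Level using (0ℓ; _⊔_) renaming (suc to lsuc)
open import Algebra.Bundles using (CommutativeRing)
open import Algebra.Structures using (IsCommutativeRing)
open import Data.Empty using (⊥-elim)
open import Data.Fin using (Fin; zero; suc; punchIn; combine; remQuot; inject≤)
open import Data.Fin.Properties
  using (all?; ¬∀⟶∃¬; punchInᵢ≢i; remQuot-combine; inject≤-injective)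
open import Data.Integer using (ℤ; +_; 0ℤ; 1ℤ)
open import Data.List as List using (List; length)
import Data.List.Relation.Unary.All as All
open import Data.List.Membership.Propositional.Properties using (∈-lookup)
open import Data.List.Relation.Unary.AllPairs as AllPairs using (AllPairs; []; _∷_)
open import Data.Nat as ℕ using (ℕ; zero; suc; s≤s; _<_; NonZero)
open import Data.Nat.Properties using (<⇒≤; n<1+n; ≰⇒>)
open import Data.Nat.Primality using (Prime)
open import Data.Product using (Σ-syntax; ∃-syntax; _×_; _,_)
open import Data.Vec using (Vec; []; _∷_; lookup)
open import Data.Vec.Functional using (insertAt)
open import Data.Vec.Functional.Properties using (insertAt-lookup; insertAt-punchIn)
open import Function using (_∘_)
open import Relation.Binary.Definitions using (Decidable; Symmetric)
open import Relation.Binary.PropositionalEquality using (_≡_; _≢_; refl; cong; cong₂; subst)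
  renaming (sym to ≡-sym; trans to ≡-trans)
open import Relation.Nullary using (¬_; yes; no; contradiction)

record DecIntegralDomain c ℓ : Set (lsuc (c ⊔ ℓ)) where
  field
    commutativeRing : CommutativeRing c ℓ
  open CommutativeRing commutativeRing public
  infix 4 _≟_
  field
    _≟_       : Decidable _≈_
    1≉0       : 1# ≉ 0#
    *-nonzero : ∀ {x y} → x ≉ 0# → y ≉ 0# → x * y ≉ 0#

module DecIntegralDomainProperties {c ℓ} (D : DecIntegralDomain c ℓ) where
  open DecIntegralDomain D
  open import Algebra.Definitions _≈_ using (AlmostRightCancellative)
  open import Algebra.Properties.Ring ring using (-‿distribˡ-*)
  open import Algebra.Properties.Group +-group using (x∙y⁻¹≈ε⇒x≈y)
  open import Relation.Binary.Reasoning.Setoid setoid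

  *-cancelʳ-nonzero : AlmostRightCancellative 0# _*_
  *-cancelʳ-nonzero z x y z≉0 xz≈yz with x - y ≟ 0#
  ... | yes x-y≈0 = x∙y⁻¹≈ε⇒x≈y x y x-y≈0
  ... | no  x-y≉0 = contradiction (begin
    (x - y) * z        ≈⟨ distribʳ z x (- y) ⟩
    x * z + - y * z    ≈⟨ +-congˡ (-‿distribˡ-* y z) ⟨
    x * z - y * z      ≈⟨ +-congʳ xz≈yz ⟩
    y * z - y * z      ≈⟨ -‿inverseʳ (y * z) ⟩
    0#                 ∎) (*-nonzero x-y≉0 z≉0)

  x≉0∧x*y≈0⇒y≈0 : ∀ {x y} → x ≉ 0# → x * y ≈ 0# → y ≈ 0#
  x≉0∧x*y≈0⇒y≈0 {x} {y} x≉0 xy≈0 with y ≟ 0#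
  ... | yes y≈0 = y≈0
  ... | no  y≉0 = contradiction xy≈0 (*-nonzero x≉0 y≉0)

module LinearDependence {c ℓ} (D : DecIntegralDomain c ℓ) where
  open DecIntegralDomain D hiding (zero)
    renaming (refl to ≈-refl; sym to ≈-sym; trans to ≈-trans)
  open import Algebra.Properties.Ring ring using (-‿distribˡ-*; -‿distribʳ-*)
  open import Algebra.Properties.CommutativeSemigroup *-commutativeSemigroup using (x∙yz≈y∙xz)
  open import Algebra.Properties.Semiring.Sum semiring
  open import Relation.Binary.Reasoning.Setoid setoid

  LinearlyDependent : ∀ {m d} → (Fin m → Fin d → Carrier) → Set (c ⊔ ℓ)
  LinearlyDependent {m} v =
    Σ[ a ∈ (Fin m → Carrier) ] (∃[ j ] a j ≉ 0#) × (∀ k → ∑[ j < m ] (a j * v j k) ≈ 0#)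

  sum-zero : ∀ {m} (f : Fin m → Carrier) → (∀ j → f j ≈ 0#) → sum f ≈ 0#
  sum-zero {m} f f≈0 = ≈-trans (sum-cong-≋ f≈0) (sum-replicate-zero m)

  dependent-dropZeroColumn : ∀ {m d} (v : Fin m → Fin (suc d) → Carrier) →
    (∀ j → v j zero ≈ 0#) → LinearlyDependent (λ j k → v j (suc k)) → LinearlyDependent v
  dependent-dropZeroColumn v v≈0 (a , nontrivial , relation) = a , nontrivial , λ where
    zero    → sum-zero _ (λ j → ≈-trans (*-congˡ (v≈0 j)) (zeroʳ (a j)))
    (suc k) → relation k

  -- Fraction-free Gaussian elimination on the first column with pivot v j₀ zero: a relation among
  -- the rows of `eliminated` lifts to a relation among the rows of v.
  module Elimination {m d} (v : Fin (suc m) → Fin (suc d) → Carrier) (j₀ : Fin (suc m)) where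
    pivot : Carrier
    pivot = v j₀ zero

    eliminated : Fin m → Fin (suc d) → Carrier
    eliminated l k = pivot * v (punchIn j₀ l) k - v (punchIn j₀ l) zero * v j₀ k

    eliminated-zero : ∀ l → eliminated l zero ≈ 0#
    eliminated-zero l = ≈-trans (+-congˡ (-‿cong (*-comm _ pivot))) (-‿inverseʳ _)

    lift : (Fin m → Carrier) → Fin (suc m) → Carrier
    lift b = insertAt (λ l → pivot * b l) j₀ (∑[ l < m ] (- (b l * v (punchIn j₀ l) zero)))

    private
      expand : ∀ β ω υ π ξ → - (β * ω) * υ + π * β * ξ ≈ β * (π * ξ - ω * υ)
      expand β ω υ π ξ = ≈-sym (begin
        β * (π * ξ - ω * υ)
          ≈⟨ distribˡ β (π * ξ) (- (ω * υ)) ⟩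
        β * (π * ξ) + β * - (ω * υ)
          ≈⟨ +-cong (x∙yz≈y∙xz β π ξ) (≈-sym (-‿distribʳ-* β (ω * υ))) ⟩
        π * (β * ξ) + - (β * (ω * υ))
          ≈⟨ +-cong (≈-sym (*-assoc π β ξ)) (-‿cong (≈-sym (*-assoc β ω υ))) ⟩
        π * β * ξ + - (β * ω * υ)
          ≈⟨ +-congˡ (-‿distribˡ-* (β * ω) υ) ⟩
        π * β * ξ + - (β * ω) * υ
          ≈⟨ +-comm _ _ ⟩
        - (β * ω) * υ + π * β * ξ ∎)

    sum-lift : ∀ b k → ∑[ j < suc m ] (lift b j * v j k) ≈ ∑[ l < m ] (b l * eliminated l k)
    sum-lift b k = begin
      ∑[ j < suc m ] (lift b j * v j k)
        ≈⟨ sum-remove {i = j₀} (λ j → lift b j * v j k) ⟩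
      lift b j₀ * y + ∑[ l < m ] (lift b (punchIn j₀ l) * x l)
        ≡⟨ cong₂ _+_ (cong (_* y) (insertAt-lookup _ j₀ _))
                     (sum-cong-≗ (λ l → cong (_* x l) (insertAt-punchIn _ j₀ _ l))) ⟩
      (∑[ l < m ] (- (b l * w l))) * y + ∑[ l < m ] (pivot * b l * x l)
        ≈⟨ +-congʳ (*-distribʳ-sum y (λ l → - (b l * w l))) ⟩
      ∑[ l < m ] (- (b l * w l) * y) + ∑[ l < m ] (pivot * b l * x l)
        ≈⟨ ≈-sym (∑-distrib-+ (λ l → - (b l * w l) * y) (λ l → pivot * b l * x l)) ⟩
      ∑[ l < m ] (- (b l * w l) * y + pivot * b l * x l)
        ≈⟨ sum-cong-≋ (λ l → expand (b l) (w l) y pivot (x l)) ⟩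
      ∑[ l < m ] (b l * eliminated l k) ∎
      where
      w x : Fin m → Carrier
      w l = v (punchIn j₀ l) zero
      x l = v (punchIn j₀ l) k
      y = v j₀ k

    dependent-lift : pivot ≉ 0# → LinearlyDependent (λ l k → eliminated l (suc k)) →
      LinearlyDependent v
    dependent-lift pivot≉0 (b , (l₀ , b≉0) , relation) =
      lift b , (punchIn j₀ l₀ , lift-nonzero) , λ k → ≈-trans (sum-lift b k) (relation′ k)
      where
      lift-nonzero : lift b (punchIn j₀ l₀) ≉ 0#
      lift-nonzero lift≈0 =
        *-nonzero pivot≉0 b≉0 (≈-trans (reflexive (≡-sym (insertAt-punchIn _ j₀ _ l₀))) lift≈0)
      relation′ : ∀ k → ∑[ l < m ] (b l * eliminated l k) ≈ 0#
      relation′ zero    = sum-zero _ (λ l → ≈-trans (*-congˡ (eliminated-zero l)) (zeroʳ (b l)))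
      relation′ (suc k) = relation k

  linearlyDependent : ∀ {m d} → d < m → (v : Fin m → Fin d → Carrier) → LinearlyDependent v
  linearlyDependent {suc m} {zero} _ v = e₀ , (zero , 1≉0) , λ ()
    where
    e₀ : Fin (suc m) → Carrier
    e₀ zero    = 1#
    e₀ (suc _) = 0#
  linearlyDependent {suc m} {suc d} (s≤s d<m) v with all? (λ j → v j zero ≟ 0#)
  ... | yes column≈0 = dependent-dropZeroColumn v column≈0
                         (linearlyDependent (s≤s (<⇒≤ d<m)) (λ j k → v j (suc k)))
  ... | no ¬column≈0 with ¬∀⟶∃¬ _ _ (λ j → v j zero ≟ 0#) ¬column≈0
  ...   | j₀ , pivot≉0 = Elimination.dependent-lift v j₀ pivot≉0
                           (linearlyDependent d<m (λ l k → Elimination.eliminated v j₀ l (suc k)))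

AllPairs-lookup : ∀ {a r} {A : Set a} {R : A → A → Set r} → Symmetric R →
  ∀ {xs} → AllPairs R xs → ∀ {i j} → i ≢ j → R (List.lookup xs i) (List.lookup xs j)
AllPairs-lookup sym (_  ∷ _)     {zero}  {zero}  0≢0 = contradiction refl 0≢0
AllPairs-lookup sym (Rx ∷ _)     {zero}  {suc j} _   = All.lookup Rx (∈-lookup j)
AllPairs-lookup sym (Rx ∷ _)     {suc i} {zero}  _   = sym (All.lookup Rx (∈-lookup i))
AllPairs-lookup sym (_  ∷ pairs) {suc i} {suc j} i≢j = AllPairs-lookup sym pairs (i≢j ∘ cong suc)

module HammingDistance where
  open import Data.Fin.Properties using (_≟_)

  dH-sym : ∀ {q n} (x y : Vec (Fin q) n) → dH x y ≡ dH y x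
  dH-sym [] [] = refl
  dH-sym (x ∷ xs) (y ∷ ys) with x ≟ y | y ≟ x
  ... | yes _   | yes _   = dH-sym xs ys
  ... | no  _   | no  _   = cong suc (dH-sym xs ys)
  ... | yes x≡y | no  y≢x = contradiction (≡-sym x≡y) y≢x
  ... | no  x≢y | yes y≡x = contradiction (≡-sym y≡x) x≢y

  dH-self : ∀ {q n} (x : Vec (Fin q) n) → dH x x ≡ 0
  dH-self [] = refl
  dH-self (x ∷ xs) with x ≟ x
  ... | yes _   = dH-self xs
  ... | no  x≢x = ⊥-elim (x≢x refl)

open HammingDistance

module IntegersModulo (p : ℕ) .{{_ : NonZero p}} where
  open import Data.Integer using (_+_; _*_; -_; _-_; ∣_∣)
  import Data.Integer.Properties as ℤ
  open import Data.Integer.Divisibility.Signed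
    using (_∣_; _∣?_; divides; ∣-refl; ∣m∣n⇒∣m+n; ∣m⇒∣-m; ∣n⇒∣m*n; ∣m⇒∣m*n; ∣⇒∣ᵤ; ∣ᵤ⇒∣)
  open import Data.Integer.Tactic.RingSolver using (solve-∀)
  open import Data.Nat.Properties using (≤-<-trans; ⊔-pres-<m)
  open import Data.Nat.DivMod using (_%_; _/_; m≡m%n+[m/n]*n; m%n<n)
  open import Data.Nat.Divisibility using (∣1⇒≡1; >⇒∤; n∣m⇒m%n≡0) renaming (_∣_ to _∣ℕ_)
  open import Data.Nat.Primality using (euclidsLemma; ¬prime[1])
  open import Data.Sum using (inj₁; inj₂)
  open import Relation.Nullary.Decidable using (map′)
  open import Relation.Binary.PropositionalEquality using (module ≡-Reasoning)
  open ≡-Reasoning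

  -- A record rather than a plain definition, so that x and y can be inferred from a proof of x ≈ y.
  infix 4 _≈_
  record _≈_ (x y : ℤ) : Set where
    constructor congruent
    field divides-difference : + p ∣ x - y
  open _≈_ public

  private
    via : ∀ {x y} (e : ℤ) → e ≡ x - y → + p ∣ e → x ≈ y
    via e refl = congruent

  ≡⇒≈ : ∀ {x y} → x ≡ y → x ≈ y
  ≡⇒≈ {x} refl = congruent (divides 0ℤ (ℤ.+-inverseʳ x))

  ≈-sym : ∀ {x y} → x ≈ y → y ≈ x
  ≈-sym {x} {y} (congruent d) = via _ (lemma x y) (∣m⇒∣-m d)
    where lemma : ∀ x y → - (x - y) ≡ y - x
          lemma = solve-∀

  ≈-trans : ∀ {x y z} → x ≈ y → y ≈ z → x ≈ z
  ≈-trans {x} {y} {z} (congruent d) (congruent e) = via _ (lemma x y z) (∣m∣n⇒∣m+n d e)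
    where lemma : ∀ x y z → (x - y) + (y - z) ≡ x - z
          lemma = solve-∀

  +-cong : ∀ {x y u v} → x ≈ y → u ≈ v → x + u ≈ y + v
  +-cong {x} {y} {u} {v} (congruent d) (congruent e) = via _ (lemma x y u v) (∣m∣n⇒∣m+n d e)
    where lemma : ∀ x y u v → (x - y) + (u - v) ≡ (x + u) - (y + v)
          lemma = solve-∀

  *-cong : ∀ {x y u v} → x ≈ y → u ≈ v → x * u ≈ y * v
  *-cong {x} {y} {u} {v} (congruent d) (congruent e) =
    via _ (lemma x y u v) (∣m∣n⇒∣m+n (∣m⇒∣m*n u d) (∣n⇒∣m*n y e))
    where lemma : ∀ x y u v → (x - y) * u + y * (u - v) ≡ x * u - y * v
          lemma = solve-∀

  -‿cong : ∀ {x y} → x ≈ y → - x ≈ - y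
  -‿cong {x} {y} (congruent d) = via _ (lemma x y) (∣m⇒∣-m d)
    where lemma : ∀ x y → - (x - y) ≡ - x - - y
          lemma = solve-∀

  isCommutativeRing : IsCommutativeRing _≈_ _+_ _*_ -_ 0ℤ 1ℤ
  isCommutativeRing = record
    { isRing = record
      { +-isAbelianGroup = record
        { isGroup = record
          { isMonoid = record
            { isSemigroup = record
              { isMagma = record
                { isEquivalence = record { refl = ≡⇒≈ refl ; sym = ≈-sym ; trans = ≈-trans }
                ; ∙-cong = +-cong
                }
              ; assoc = λ x y z → ≡⇒≈ (ℤ.+-assoc x y z)
              }
            ; identity = (λ x → ≡⇒≈ (ℤ.+-identityˡ x)) , (λ x → ≡⇒≈ (ℤ.+-identityʳ x))
            }
          ; inverse = (λ x → ≡⇒≈ (ℤ.+-inverseˡ x)) , (λ x → ≡⇒≈ (ℤ.+-inverseʳ x))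
          ; ⁻¹-cong = -‿cong
          }
        ; comm = λ x y → ≡⇒≈ (ℤ.+-comm x y)
        }
      ; *-cong = *-cong
      ; *-assoc = λ x y z → ≡⇒≈ (ℤ.*-assoc x y z)
      ; *-identity = (λ x → ≡⇒≈ (ℤ.*-identityˡ x)) , (λ x → ≡⇒≈ (ℤ.*-identityʳ x))
      ; distrib = (λ x y z → ≡⇒≈ (ℤ.*-distribˡ-+ x y z))
                , (λ x y z → ≡⇒≈ (ℤ.*-distribʳ-+ x y z))
      }
    ; *-comm = λ x y → ≡⇒≈ (ℤ.*-comm x y)
    }

  ≈0⇒∣ : ∀ {x} → x ≈ 0ℤ → + p ∣ x
  ≈0⇒∣ {x} (congruent d) = subst (+ p ∣_) (ℤ.+-identityʳ x) d

  ∣⇒≈0 : ∀ {x} → + p ∣ x → x ≈ 0ℤ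
  ∣⇒≈0 {x} d = congruent (subst (+ p ∣_) (≡-sym (ℤ.+-identityʳ x)) d)

  +m≈+[m%p] : ∀ m → + m ≈ + (m % p)
  +m≈+[m%p] m = via (+ (m / p) * + p) (≡-sym (begin
    + m - + r                         ≡⟨ cong (λ t → + t - + r) (m≡m%n+[m/n]*n m p) ⟩
    + (r ℕ.+ m / p ℕ.* p) - + r       ≡⟨ cong (λ t → + r + t - + r) (ℤ.pos-* (m / p) p) ⟩
    + r + + (m / p) * + p - + r       ≡⟨ cancel (+ r) (+ (m / p) * + p) ⟩
    + (m / p) * + p                   ∎))
    (∣n⇒∣m*n (+ (m / p)) ∣-refl)
    where
    r : ℕ
    r = m % p
    cancel : ∀ x y → x + y - x ≡ y
    cancel = solve-∀

  residue-≈⇒≡ : ∀ {r s} → r < p → s < p → + r ≈ + s → r ≡ s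
  residue-≈⇒≡ {r} {s} r<p s<p (congruent d) =
    ℤ.+-injective (ℤ.i-j≡0⇒i≡j (+ r) (+ s) (ℤ.∣i∣≡0⇒i≡0 (multiple<p (∣⇒∣ᵤ d) ∣r-s∣<p)))
    where
    multiple<p : ∀ {k} → p ∣ℕ k → k < p → k ≡ 0
    multiple<p {zero}  _   _   = refl
    multiple<p {suc k} p∣k k<p = ⊥-elim (>⇒∤ k<p p∣k)
    ∣r-s∣<p : ∣ + r - + s ∣ < p
    ∣r-s∣<p rewrite ℤ.m-n≡m⊖n r s = ≤-<-trans (ℤ.∣m⊝n∣≤m⊔n r s) (⊔-pres-<m r<p s<p)

  ≈⇒%≡ : ∀ {m n} → + m ≈ + n → m % p ≡ n % p
  ≈⇒%≡ {m} {n} m≈n = residue-≈⇒≡ (m%n<n m p) (m%n<n n p)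
    (≈-trans (≈-sym (+m≈+[m%p] m)) (≈-trans m≈n (+m≈+[m%p] n)))

  %≡⇒≈ : ∀ {m n} → m % p ≡ n % p → + m ≈ + n
  %≡⇒≈ {m} {n} m%p≡n%p =
    ≈-trans (+m≈+[m%p] m) (≈-trans (≡⇒≈ (cong +_ m%p≡n%p)) (≈-sym (+m≈+[m%p] n)))

  %≢0⇒≉0 : ∀ {m} → m % p ≢ 0 → ¬ (+ m ≈ 0ℤ)
  %≢0⇒≉0 {m} m%p≢0 m≈0 = m%p≢0 (n∣m⇒m%n≡0 m p (∣⇒∣ᵤ (≈0⇒∣ m≈0)))

  module _ (prime : Prime p) where

    1≉0 : ¬ (1ℤ ≈ 0ℤ)
    1≉0 (congruent p∣1) = ¬prime[1] (subst Prime (∣1⇒≡1 (∣⇒∣ᵤ p∣1)) prime)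

    *-nonzero : ∀ {x y} → ¬ (x ≈ 0ℤ) → ¬ (y ≈ 0ℤ) → ¬ (x * y ≈ 0ℤ)
    *-nonzero {x} {y} x≉0 y≉0 xy≈0
      with euclidsLemma ∣ x ∣ ∣ y ∣ prime
             (subst (p ∣ℕ_) (ℤ.abs-* x y) (∣⇒∣ᵤ (≈0⇒∣ {x * y} xy≈0)))
    ... | inj₁ p∣x = x≉0 (∣⇒≈0 {x} (∣ᵤ⇒∣ p∣x))
    ... | inj₂ p∣y = y≉0 (∣⇒≈0 {y} (∣ᵤ⇒∣ p∣y))

    ℤ/p : DecIntegralDomain 0ℓ 0ℓ
    ℤ/p = record
      { commutativeRing = record { isCommutativeRing = isCommutativeRing }
      ; _≟_ = λ x y → map′ congruent divides-difference (+ p ∣? (x - y))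
      ; 1≉0 = 1≉0
      ; *-nonzero = *-nonzero
      }

module Equidistant (p : ℕ) .{{_ : NonZero p}} (prime : Prime p) where
  open import Data.Fin.Properties using (_≟_)
  import Data.Integer as ℤ
  import Data.Integer.Properties as ℤ
  open import Data.Integer.Tactic.RingSolver using (solve-∀)
  open import Algebra.Properties.CommutativeSemigroup ℤ.+-commutativeSemigroup
    using () renaming (interchange to +-interchange)
  open IntegersModulo p using (ℤ/p)
  open DecIntegralDomain (ℤ/p prime) hiding (zero; _≟_)
    renaming (refl to ≈-refl; sym to ≈-sym; trans to ≈-trans)
  open DecIntegralDomainProperties (ℤ/p prime) using (*-cancelʳ-nonzero; x≉0∧x*y≈0⇒y≈0)
  open LinearDependence (ℤ/p prime) using (sum-zero; linearlyDependent)
  open import Algebra.Properties.Group +-group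
    using (x∙y⁻¹≈ε⇒x≈y) renaming (∙-cancelʳ to +-cancelʳ)
  open import Algebra.Properties.Semiring.Sum semiring
  open import Relation.Binary.Reasoning.Setoid setoid

  δ : ∀ {q} → Fin q → Fin q → ℤ
  δ x y with x ≟ y
  ... | yes _ = 1ℤ
  ... | no  _ = 0ℤ

  δ-diag : ∀ {q} (x : Fin q) → δ x x ≡ 1ℤ
  δ-diag x with x ≟ x
  ... | yes _   = refl
  ... | no  x≢x = ⊥-elim (x≢x refl)

  δ-off-diag : ∀ {q} {x y : Fin q} → x ≢ y → δ x y ≡ 0ℤ
  δ-off-diag {x = x} {y} x≢y with x ≟ y
  ... | yes x≡y = ⊥-elim (x≢y x≡y)
  ... | no  _   = refl

  ∑δ≈1 : ∀ {q} (x : Fin q) → ∑[ b < q ] δ x b ≈ 1#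
  ∑δ≈1 {suc q} x = begin
    ∑[ b < suc q ] δ x b                  ≈⟨ sum-remove {i = x} (δ x) ⟩
    δ x x + ∑[ l < q ] δ x (punchIn x l)  ≈⟨ +-cong (reflexive (δ-diag x)) off-diagonal ⟩
    1# + 0#                               ≈⟨ +-identityʳ 1# ⟩
    1#                                    ∎
    where
    off-diagonal : ∑[ l < q ] δ x (punchIn x l) ≈ 0#
    off-diagonal = sum-zero _ (λ l → reflexive (δ-off-diag (punchInᵢ≢i x l ∘ ≡-sym)))

  sum-const : ∀ m x → ∑[ j < m ] x ≈ + m * x
  sum-const zero    x = reflexive (≡-sym (ℤ.*-zeroˡ x))
  sum-const (suc m) x = ≈-trans (+-congˡ {x} (sum-const m x)) (reflexive (lemma (+ m) x))
    where lemma : ∀ m x → x ℤ.+ m ℤ.* x ≡ (1ℤ ℤ.+ m) ℤ.* x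
          lemma = solve-∀

  agreement : ∀ {q n} → Vec (Fin q) n → Vec (Fin q) n → ℤ
  agreement {n = n} x y = ∑[ i < n ] δ (lookup x i) (lookup y i)

  dH+agreement : ∀ {q n} (x y : Vec (Fin q) n) → + dH x y + agreement x y ≡ + n
  dH+agreement [] [] = refl
  dH+agreement (x ∷ xs) (y ∷ ys) with x ≟ y
  ... | yes _ = ≡-trans (+-interchange 0ℤ (+ dH xs ys) 1ℤ (agreement xs ys))
                        (cong (_+_ 1ℤ) (dH+agreement xs ys))
  ... | no  _ = ≡-trans (+-interchange 1ℤ (+ dH xs ys) 0ℤ (agreement xs ys))
                        (cong (_+_ 1ℤ) (dH+agreement xs ys))

  agreement≡n-dH : ∀ {q n} (x y : Vec (Fin q) n) → agreement x y ≡ + n - + dH x y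
  agreement≡n-dH x y =
    ≡-trans (cancel (+ dH x y) (agreement x y)) (cong (_- + dH x y) (dH+agreement x y))
    where cancel : ∀ d a → a ≡ d ℤ.+ a ℤ.- d
          cancel = solve-∀

  -- The point of ℤ^{n(q−1)} attached to a word, with coordinates indexed by i < n and 0 < a < q
  -- (the letter a is represented by suc a).
  embed : ∀ {n s} → Vec (Fin (suc s)) n → Fin n × Fin s → ℤ
  embed x (i , a) = δ (lookup x i) (suc a) - δ (lookup x i) zero

  module LinearRelation {n s : ℕ} {λ′ : ℤ}
    (h : Fin (suc (n ℕ.* s)) → Vec (Fin (suc s)) n)
    (equidistant : ∀ {j j′} → j ≢ j′ → + dH (h j) (h j′) ≈ λ′)
    (c : Fin (suc (n ℕ.* s)) → ℤ)
    (relation : ∀ k → ∑[ j < suc (n ℕ.* s) ] (c j * embed (h j) (remQuot s k)) ≈ 0#)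
    where

    m q : ℕ
    m = suc (n ℕ.* s)
    q = suc s

    column : Fin n → Fin q → ℤ
    column i b = ∑[ j < m ] (c j * δ (lookup (h j) i) b)

    column≈column₀ : ∀ i b → column i b ≈ column i zero
    column≈column₀ i zero    = ≈-refl
    column≈column₀ i (suc a) = begin
      column i (suc a)
        ≈⟨ sum-cong-≋ (λ j → reflexive (split (c j) (δ₁ j) (δ₀ j))) ⟩
      ∑[ j < m ] (c j * δ₀ j + c j * embed (h j) (i , a))
        ≈⟨ ∑-distrib-+ (λ j → c j * δ₀ j) (λ j → c j * embed (h j) (i , a)) ⟩
      column i zero + ∑[ j < m ] (c j * embed (h j) (i , a))
        ≈⟨ +-congˡ {column i zero} (≈-trans (reflexive (sum-cong-≗ at-combine))
                                            (relation (combine i a))) ⟩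
      column i zero + 0#
        ≈⟨ +-identityʳ _ ⟩
      column i zero ∎
      where
      δ₀ δ₁ : Fin m → ℤ
      δ₀ j = δ (lookup (h j) i) zero
      δ₁ j = δ (lookup (h j) i) (suc a)
      split : ∀ c y z → c ℤ.* y ≡ c ℤ.* z ℤ.+ c ℤ.* (y ℤ.- z)
      split = solve-∀
      at-combine : ∀ j → c j * embed (h j) (i , a) ≡ c j * embed (h j) (remQuot s (combine i a))
      at-combine j = cong (λ t → c j * embed (h j) t) (≡-sym (remQuot-combine i a))

    C : ℤ
    C = ∑[ j < m ] c j

    ∑column≈C : ∀ i → ∑[ b < q ] column i b ≈ C
    ∑column≈C i = begin
      ∑[ b < q ] column i b
        ≈⟨ ∑-comm (λ b j → c j * δ (lookup (h j) i) b) ⟩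
      ∑[ j < m ] ∑[ b < q ] (c j * δ (lookup (h j) i) b)
        ≈⟨ sum-cong-≋ (λ j → ≈-sym (*-distribˡ-sum (c j) (δ (lookup (h j) i)))) ⟩
      ∑[ j < m ] (c j * ∑[ b < q ] δ (lookup (h j) i) b)
        ≈⟨ sum-cong-≋ (λ j → ≈-trans (*-congˡ {c j} (∑δ≈1 (lookup (h j) i))) (*-identityʳ (c j))) ⟩
      C ∎

    q*column₀≈C : ∀ i → + q * column i zero ≈ C
    q*column₀≈C i = begin
      + q * column i zero       ≈⟨ sum-const q (column i zero) ⟨
      ∑[ b < q ] column i zero  ≈⟨ sum-cong-≋ (λ b → ≈-sym (column≈column₀ i b)) ⟩
      ∑[ b < q ] column i b     ≈⟨ ∑column≈C i ⟩
      C                         ∎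

    T : ℤ
    T = ∑[ i < n ] column i zero

    q*T≈n*C : + q * T ≈ + n * C
    q*T≈n*C = begin
      + q * T                           ≈⟨ *-distribˡ-sum (+ q) (λ i → column i zero) ⟩
      ∑[ i < n ] (+ q * column i zero)  ≈⟨ sum-cong-≋ q*column₀≈C ⟩
      ∑[ i < n ] C                      ≈⟨ sum-const n C ⟩
      + n * C                           ∎

    weightedAgreement : Fin m → ℤ
    weightedAgreement g = ∑[ j < m ] (c j * agreement (h j) (h g))

    weightedAgreement≈T : ∀ g → weightedAgreement g ≈ T
    weightedAgreement≈T g = begin
      weightedAgreement g
        ≈⟨ sum-cong-≋ (λ j → *-distribˡ-sum (c j) (λ i → δ (lookup (h j) i) (lookup (h g) i))) ⟩
      ∑[ j < m ] ∑[ i < n ] (c j * δ (lookup (h j) i) (lookup (h g) i))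
        ≈⟨ ∑-comm (λ j i → c j * δ (lookup (h j) i) (lookup (h g) i)) ⟩
      ∑[ i < n ] column i (lookup (h g) i)
        ≈⟨ sum-cong-≋ (λ i → column≈column₀ i (lookup (h g) i)) ⟩
      T ∎

    agreement-distinct : ∀ {j g} → j ≢ g → agreement (h j) (h g) ≈ + n - λ′
    agreement-distinct {j} {g} j≢g = ≈-trans (reflexive (agreement≡n-dH (h j) (h g)))
                                             (+-congˡ {+ n} (-‿cong (equidistant j≢g)))

    agreement-self : ∀ g → agreement (h g) (h g) ≈ + n
    agreement-self g = begin
      agreement (h g) (h g)   ≡⟨ agreement≡n-dH (h g) (h g) ⟩
      + n - + dH (h g) (h g)  ≡⟨ cong (λ d → + n - + d) (dH-self (h g)) ⟩
      + n - + 0               ≡⟨ ℤ.+-identityʳ (+ n) ⟩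
      + n                     ∎

    weightedAgreement≈cλ+C[n-λ] : ∀ g → weightedAgreement g ≈ c g * λ′ + C * (+ n - λ′)
    weightedAgreement≈cλ+C[n-λ] g = begin
      weightedAgreement g
        ≈⟨ sum-remove {i = g} (λ j → c j * agreement (h j) (h g)) ⟩
      c g * agreement (h g) (h g) + ∑[ l < n ℕ.* s ] (c (g′ l) * agreement (h (g′ l)) (h g))
        ≈⟨ +-cong (*-congˡ {c g} (agreement-self g))
                  (sum-cong-≋ (λ l → *-congˡ {c (g′ l)} (agreement-distinct (punchInᵢ≢i g l)))) ⟩
      c g * + n + ∑[ l < n ℕ.* s ] (c (g′ l) * (+ n - λ′))
        ≈⟨ +-congˡ {c g * + n} (≈-sym (*-distribʳ-sum (+ n - λ′) (c ∘ g′))) ⟩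
      c g * + n + (∑[ l < n ℕ.* s ] c (g′ l)) * (+ n - λ′)
        ≈⟨ reflexive (rearrange (c g) (∑[ l < n ℕ.* s ] c (g′ l)) (+ n) λ′) ⟩
      c g * λ′ + (c g + ∑[ l < n ℕ.* s ] c (g′ l)) * (+ n - λ′)
        ≈⟨ +-congˡ {c g * λ′} (*-congʳ {+ n - λ′} (sum-remove {i = g} c)) ⟨
      c g * λ′ + C * (+ n - λ′) ∎
      where
      g′ : Fin (n ℕ.* s) → Fin m
      g′ = punchIn g
      rearrange : ∀ x r N L → x ℤ.* N ℤ.+ r ℤ.* (N ℤ.- L) ≡ x ℤ.* L ℤ.+ (x ℤ.+ r) ℤ.* (N ℤ.- L)
      rearrange = solve-∀

    coefficients-equal : λ′ ≉ 0# → ∀ j j′ → c j ≈ c j′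
    coefficients-equal λ′≉0 j j′ = *-cancelʳ-nonzero λ′ (c j) (c j′) λ′≉0
      (+-cancelʳ (C * (+ n - λ′)) (c j * λ′) (c j′ * λ′) (begin
        c j * λ′ + C * (+ n - λ′)   ≈⟨ weightedAgreement≈cλ+C[n-λ] j ⟨
        weightedAgreement j         ≈⟨ weightedAgreement≈T j ⟩
        T                           ≈⟨ weightedAgreement≈T j′ ⟨
        weightedAgreement j′        ≈⟨ weightedAgreement≈cλ+C[n-λ] j′ ⟩
        c j′ * λ′ + C * (+ n - λ′)  ∎))

    M : ℤ
    M = 1ℤ + + n * + s

    m≡M : + m ≡ M
    m≡M = cong (_+_ 1ℤ) (ℤ.pos-* n s)

    module _ (λ′≉0 : λ′ ≉ 0#) (j₀ : Fin m) where

      C≈M*c₀ : C ≈ M * c j₀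
      C≈M*c₀ = begin
        C                ≈⟨ sum-cong-≋ (λ j → coefficients-equal λ′≉0 j j₀) ⟩
        ∑[ j < m ] c j₀  ≈⟨ sum-const m (c j₀) ⟩
        + m * c j₀       ≡⟨ cong (_* c j₀) m≡M ⟩
        M * c j₀         ∎

      q[c₀λ+Mc₀[n-λ]]≈nMc₀ : + q * (c j₀ * λ′ + (M * c j₀) * (+ n - λ′)) ≈ + n * (M * c j₀)
      q[c₀λ+Mc₀[n-λ]]≈nMc₀ = begin
        + q * (c j₀ * λ′ + (M * c j₀) * (+ n - λ′))
          ≈⟨ *-congˡ {+ q} (+-congˡ {c j₀ * λ′} (*-congʳ {+ n - λ′} C≈M*c₀)) ⟨
        + q * (c j₀ * λ′ + C * (+ n - λ′))
          ≈⟨ *-congˡ {+ q} (≈-trans (≈-sym (weightedAgreement≈T j₀))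
                                    (weightedAgreement≈cλ+C[n-λ] j₀)) ⟨
        + q * T           ≈⟨ q*T≈n*C ⟩
        + n * C           ≈⟨ *-congˡ {+ n} C≈M*c₀ ⟩
        + n * (M * c j₀)  ∎

    m≈qλ : λ′ ≉ 0# → + n ≉ 0# → + s ≉ 0# → ∀ j₀ → c j₀ ≉ 0# → + m ≈ + q * λ′
    m≈qλ λ′≉0 n≉0 s≉0 j₀ c₀≉0 = ≈-trans (reflexive m≡M) (x∙y⁻¹≈ε⇒x≈y M (+ q * λ′)
      (x≉0∧x*y≈0⇒y≈0 s≉0 (x≉0∧x*y≈0⇒y≈0 n≉0 (x≉0∧x*y≈0⇒y≈0 c₀≉0 (begin
        c₀ * (+ n * (+ s * (M - + q * λ′)))
          ≡⟨ identity c₀ λ′ (+ n) (+ s) ⟨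
        + q * (c₀ * λ′ + (M * c₀) * (+ n - λ′)) - + n * (M * c₀)
          ≈⟨ +-congʳ { - (+ n * (M * c₀))} (q[c₀λ+Mc₀[n-λ]]≈nMc₀ λ′≉0 j₀) ⟩
        + n * (M * c₀) - + n * (M * c₀)
          ≈⟨ -‿inverseʳ (+ n * (M * c₀)) ⟩
        0# ∎)))))
      where
      c₀ : ℤ
      c₀ = c j₀
      identity : ∀ c₀ L N S →
        (1ℤ ℤ.+ S) ℤ.* (c₀ ℤ.* L ℤ.+ ((1ℤ ℤ.+ N ℤ.* S) ℤ.* c₀) ℤ.* (N ℤ.- L))
          ℤ.- N ℤ.* ((1ℤ ℤ.+ N ℤ.* S) ℤ.* c₀)
          ≡ c₀ ℤ.* (N ℤ.* (S ℤ.* ((1ℤ ℤ.+ N ℤ.* S) ℤ.- (1ℤ ℤ.+ S) ℤ.* L)))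
      identity = solve-∀

  equidistant-congruence : ∀ {n s λ′} (h : Fin (suc (n ℕ.* s)) → Vec (Fin (suc s)) n) →
    + n ≉ 0# → + s ≉ 0# → λ′ ≉ 0# → (∀ {j j′} → j ≢ j′ → + dH (h j) (h j′) ≈ λ′) →
    + suc (n ℕ.* s) ≈ + suc s * λ′
  equidistant-congruence {n} {s} h n≉0 s≉0 λ′≉0 equidistant
    with linearlyDependent (n<1+n (n ℕ.* s)) (λ j → embed (h j) ∘ remQuot s)
  ... | c , (j₀ , c≉0) , relation =
    LinearRelation.m≈qλ h equidistant c relation λ′≉0 n≉0 s≉0 j₀ c≉0

  equidistant-bound : ∀ {n s λ′} (H : List (Vec (Fin (suc s)) n)) →
    + n ≉ 0# → + s ≉ 0# → λ′ ≉ 0# → AllPairs (λ x y → + dH x y ≈ λ′) H →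
    + suc (n ℕ.* s) ≉ + suc s * λ′ → length H ℕ.≤ n ℕ.* s
  equidistant-bound {n} {s} {λ′} H n≉0 s≉0 λ′≉0 equidistant m≉qλ with length H ℕ.≤? n ℕ.* s
  ... | yes H≤ = H≤
  ... | no  H≰ = contradiction (equidistant-congruence h n≉0 s≉0 λ′≉0 pairwise) m≉qλ
    where
    h : Fin (suc (n ℕ.* s)) → Vec (Fin (suc s)) n
    h j = List.lookup H (inject≤ j (≰⇒> H≰))
    pairwise : ∀ {j j′} → j ≢ j′ → + dH (h j) (h j′) ≈ λ′
    pairwise {j} {j′} j≢j′ =
      AllPairs-lookup (λ {x} {y} → ≈-trans (reflexive (cong +_ (dH-sym y x)))) equidistant
        (j≢j′ ∘ inject≤-injective _ _ j j′)

-- ℕ arithmetic is opened only here: the development above uses ring operations of the same names.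
open import Data.Nat using (ℕ; _*_; _+_; _∸_; _≤_; _>_; NonZero)
open import Data.Nat.DivMod using (_%_; m<n⇒m%n≡m)
open import Data.Nat.Properties using (m<n⇒n≢0; +-comm)
open import Data.Nat.Primality using (Prime)
open import Data.Fin using (Fin)
open import Data.Vec using (Vec)
open import Data.List using (List; length)
open import Data.List.Relation.Unary.Unique.Propositional using (Unique)
open import Data.List.Relation.Unary.AllPairs using (AllPairs)
open import Data.Product using (Σ; _×_)
open import Relation.Binary.PropositionalEquality using (_≡_; _≢_)
import Data.Integer as ℤ
import Data.Integer.Properties as ℤ

theorem3 : (n q p : ℕ) → n > 0 → q > 1 → .{{_ : NonZero p}} → Prime p → q ≤ p →
    n % p ≢ 0 →
    (H : List (Vec (Fin q) n)) → Unique H →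
    (Σ ℕ λ λ′ → λ′ > 0 × λ′ % p ≢ 0 ×
      AllPairs (λ h g → dH h g % p ≡ λ′ % p) H ×
      (q * λ′) % p ≢ (n * (q ∸ 1) + 1) % p) →
    length H ≤ n * (q ∸ 1)
theorem3 n (suc s) p _ (s≤s 0<s) p-prime s<p n%p≢0 H _
         (λ′ , _ , λ′%p≢0 , equidistant , qλ′≢m) =
  equidistant-bound H (%≢0⇒≉0 n%p≢0) (%≢0⇒≉0 s%p≢0) (%≢0⇒≉0 λ′%p≢0)
    (AllPairs.map %≡⇒≈ equidistant) m≉qλ
  where
  open IntegersModulo p using (_≈_; ≈-trans; ≡⇒≈; %≡⇒≈; ≈⇒%≡; %≢0⇒≉0)
  open Equidistant p p-prime using (equidistant-bound)
  s%p≢0 : s % p ≢ 0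
  s%p≢0 = m<n⇒n≢0 0<s ∘ ≡-trans (≡-sym (m<n⇒m%n≡m s<p))
  m≉qλ : ¬ (+ suc (n * s) ≈ + suc s ℤ.* + λ′)
  m≉qλ m≈qλ = qλ′≢m (≡-sym (≡-trans (cong (_% p) (+-comm (n * s) 1))
    (≈⇒%≡ (≈-trans m≈qλ (≡⇒≈ (≡-sym (ℤ.pos-* (suc s) λ′)))))))
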